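{- (1) For every positive integer $n$, $f_{T_n}(2x)=f_{T'_n}(2x)-f_{T'_{n-1}}(2x)$, and this equals $\dfrac{\sin((n+1)\theta)-\sin(n\theta)}{\sin\theta}$ whenever $\cos\theta=x$ and $\sin\theta\neq0$. (2) For every integer $n\ge 2$, $f_{T_n}(x)=xf_{T_{n-1}}(x)-f_{T_{n-2}}(x)$. (3) For every integer $n\ge 2$, $f_{A_n}(x)=x^2f_{A_{n-2}}(x)-(-1)^{n+1}f_{A_{n-1}}(-x)$.
   Context: For a square matrix $B$ of order $n$, $f_B(x)=\det(xI_n-B)$; for $n=0$ (empty matrix) $f_B=1$. $T'_n$ is the $n\times n$ matrix with $(i,j)$ entry $1$ if $|i-j|=1$ and $0$ otherwise; $T_n$ is $T'_n$ with its $(1,1)$ entry changed to $1$. $A_n$ is the $n\times n$ matrix with $(i,j)$ entry $1$ if $i+j\le n+1$ and $0$ otherwise. -}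

module Defs where

open import Level using (Level)
open import Data.Bool using (Bool; true; false; if_then_else_)
open import Data.Nat using (ℕ; zero; suc; _≡ᵇ_; _<ᵇ_; ∣_-_∣) renaming (_+_ to _+ℕ_)
open import Data.Fin using (Fin; zero; suc; toℕ; punchIn)
open import Algebra.Bundles using (CommutativeRing)

-- 0/1 matrices of order n, as Boolean patterns (true = 1, false = 0).
-- Indices are Fin n; Fin index k corresponds to the paper's index k+1.
BMat : ℕ → Set
BMat n = Fin n → Fin n → Bool

T′ : (n : ℕ) → BMat n
T′ n i j = ∣ toℕ i - toℕ j ∣ ≡ᵇ 1

T : (n : ℕ) → BMat n
T n zero zero = true
T n i j = T′ n i j

-- A_n : (i,j) entry 1 iff i + j ≤ n + 1 (1-based); with 0-based Fin indices
-- i' = i-1, j' = j-1 this is i' + j' + 2 ≤ n + 1, i.e. i' + j' < n.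
A : (n : ℕ) → BMat n
A n i j = (toℕ i +ℕ toℕ j) <ᵇ n

module CharPoly {c ℓ : Level} (R : CommutativeRing c ℓ) where
  open CommutativeRing R using (Carrier; _+_; _*_; -_; _-_; 0#; 1#)

  sumFin : (n : ℕ) → (Fin n → Carrier) → Carrier
  sumFin zero    g = 0#
  sumFin (suc n) g = g zero + sumFin n (λ j → g (suc j))

  sign : ℕ → Carrier
  sign zero    = 1#
  sign (suc k) = - sign k

  det : (n : ℕ) → (Fin n → Fin n → Carrier) → Carrier
  det zero    M = 1#
  det (suc n) M = sumFin (suc n) (λ j → sign (toℕ j) * (M zero j * det n (λ i k → M (suc i) (punchIn j k))))

  embed : {n : ℕ} → BMat n → Fin n → Fin n → Carrier
  embed B i j = if B i j then 1# else 0#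

  δ : {n : ℕ} → Fin n → Fin n → Carrier
  δ i j = if toℕ i ≡ᵇ toℕ j then 1# else 0#

  f : (n : ℕ) → BMat n → Carrier → Carrier
  f n B x = det n (λ i j → x * δ i j - embed B i j)

{-# OPTIONS --safe #-}
-- T_n and T'_n differ only in the corner entry, so the determinant, being affine in that entry,
-- gives (1a). T'_n is tridiagonal, so its characteristic polynomials P_n satisfy
-- P_{n+2} = 2x P_{n+1} - P_n, the recurrence of sin((n+1)θ)/sin θ, which gives (1b); (2) follows
-- because the differences P_n - P_{n-1} satisfy the same recurrence. For (3), split the first row
-- of xI - A_n as x e₀ - (1, …, 1). The first part leaves a minor whose last row and column vanish
-- off the diagonal, contributing x² f_{A_{n-2}}(x). In the second part, subtracting the first
-- column from all others leaves -1 in the corner above J (xI + A_{n-1}) J, with J the reversal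
-- permutation, and det (xI + A_{n-1}) = (-1)^{n-1} f_{A_{n-1}}(-x).
module Submission where

open import Level using (Level)
open import Algebra.Bundles using (CommutativeRing)
open import Algebra.Solver.Ring.AlmostCommutativeRing using (fromCommutativeRing; _-Raw-AlmostCommutative⟶_)
open import Data.Bool using (Bool; true; false; if_then_else_; not)
open import Data.Fin using (Fin; zero; suc; toℕ; punchIn)
open import Data.Integer as ℤ using (ℤ; +_; -[1+_]; _⊖_; +-*-rawRing)
import Data.Integer.Properties as ℤₚ
open import Data.Maybe using (Maybe; just; nothing)
open import Data.Nat using (ℕ; zero; suc; _∸_; ∣_-_∣; _<_; _≤_; _<ᵇ_; _≡ᵇ_; s≤s; z<s; s<s)
import Data.Nat as ℕ
import Data.Nat.Properties as ℕₚ
open import Data.Product using (_×_; _,_; proj₁; proj₂)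
import Data.Sign as Sign
open import Function using (_∘_)
open import Relation.Binary.PropositionalEquality as ≡ using (_≡_; _≢_)
open import Relation.Nullary using (¬_; yes; no; contradiction)
open import Relation.Nullary.Decidable using (dec-true; dec-false)

open import Defs

-- ℤ maps into every commutative ring; taking ℤ as coefficient ring lets Algebra.Solver.Ring
-- normalise identities involving integer constants.
module IntegerCoefficients {c ℓ} (R : CommutativeRing c ℓ) where
  open CommutativeRing R
  open import Algebra.Properties.Ring ring using (-0#≈0#; -‿involutive; -1*x≈-x)
  open import Algebra.Properties.AbelianGroup +-abelianGroup using (⁻¹-∙-comm)
  open import Algebra.Properties.CommutativeSemigroup *-commutativeSemigroup using (interchange)
  open import Algebra.Properties.Semiring.Mult.TCOptimised semiring using (1+×; ×-homo-+; ×1-homo-*) renaming (_×_ to _×′_)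
  open import Relation.Binary.Reasoning.Setoid setoid

  fromℤ : ℤ → Carrier
  fromℤ (+ n)      = n ×′ 1#
  fromℤ -[1+ n ]   = - (suc n ×′ 1#)

  private
    [1+a]-[1+b]≈a-b : ∀ a b → (1# + a) - (1# + b) ≈ a - b
    [1+a]-[1+b]≈a-b a b = begin
      (1# + a) + - (1# + b)    ≈⟨ +-congˡ (⁻¹-∙-comm 1# b) ⟨
      (1# + a) + (- 1# + - b)  ≈⟨ +-assoc 1# a _ ⟩
      1# + (a + (- 1# + - b))  ≈⟨ +-congˡ (trans (sym (+-assoc a _ _)) (trans (+-congʳ (+-comm a _)) (+-assoc _ a _))) ⟩
      1# + (- 1# + (a + - b))  ≈⟨ +-assoc 1# _ _ ⟨
      (1# + - 1#) + (a + - b)  ≈⟨ +-congʳ (-‿inverseʳ 1#) ⟩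
      0# + (a - b)             ≈⟨ +-identityˡ _ ⟩
      a - b                    ∎

  fromℤ-⊖ : ∀ m n → fromℤ (m ⊖ n) ≈ m ×′ 1# - n ×′ 1#
  fromℤ-⊖ zero    zero    = sym (-‿inverseʳ 0#)
  fromℤ-⊖ zero    (suc n) = sym (+-identityˡ _)
  fromℤ-⊖ (suc m) zero    = sym (trans (+-congˡ -0#≈0#) (+-identityʳ _))
  fromℤ-⊖ (suc m) (suc n) = begin
    fromℤ (suc m ⊖ suc n)             ≡⟨ ≡.cong fromℤ (ℤₚ.[1+m]⊖[1+n]≡m⊖n m n) ⟩
    fromℤ (m ⊖ n)                     ≈⟨ fromℤ-⊖ m n ⟩
    m ×′ 1# - n ×′ 1#                 ≈⟨ [1+a]-[1+b]≈a-b _ _ ⟨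
    (1# + m ×′ 1#) - (1# + n ×′ 1#)   ≈⟨ +-cong (1+× m 1#) (-‿cong (1+× n 1#)) ⟨
    suc m ×′ 1# - suc n ×′ 1#         ∎

  fromℤ-+ : ∀ i j → fromℤ (i ℤ.+ j) ≈ fromℤ i + fromℤ j
  fromℤ-+ -[1+ m ] -[1+ n ] = begin
    - (suc (suc (m ℕ.+ n)) ×′ 1#)       ≡⟨ ≡.cong (λ k → - (suc k ×′ 1#)) (ℕₚ.+-suc m n) ⟨
    - ((suc m ℕ.+ suc n) ×′ 1#)         ≈⟨ -‿cong (×-homo-+ 1# (suc m) (suc n)) ⟩
    - (suc m ×′ 1# + suc n ×′ 1#)       ≈⟨ ⁻¹-∙-comm _ _ ⟨
    - (suc m ×′ 1#) + - (suc n ×′ 1#)   ∎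
  fromℤ-+ -[1+ m ] (+ n)    = trans (fromℤ-⊖ n (suc m)) (+-comm _ _)
  fromℤ-+ (+ m)    -[1+ n ] = fromℤ-⊖ m (suc n)
  fromℤ-+ (+ m)    (+ n)    = ×-homo-+ 1# m n

  private
    fromSign : Sign.Sign → Carrier
    fromSign Sign.+ = 1#
    fromSign Sign.- = - 1#

    fromℤ-◃ : ∀ s k → fromℤ (s ℤ.◃ k) ≈ fromSign s * (k ×′ 1#)
    fromℤ-◃ s      zero    = sym (zeroʳ _)
    fromℤ-◃ Sign.+ (suc k) = sym (*-identityˡ _)
    fromℤ-◃ Sign.- (suc k) = sym (-1*x≈-x _)

    fromSign-* : ∀ s t → fromSign (s Sign.* t) ≈ fromSign s * fromSign t
    fromSign-* Sign.+ t      = sym (*-identityˡ _)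
    fromSign-* Sign.- Sign.+ = sym (*-identityʳ _)
    fromSign-* Sign.- Sign.- = sym (trans (-1*x≈-x _) (-‿involutive 1#))

    fromSign◃abs : ∀ k → fromSign (ℤ.sign k) * (ℤ.∣ k ∣ ×′ 1#) ≈ fromℤ k
    fromSign◃abs (+ n)    = *-identityˡ _
    fromSign◃abs -[1+ n ] = -1*x≈-x _

  fromℤ-* : ∀ i j → fromℤ (i ℤ.* j) ≈ fromℤ i * fromℤ j
  fromℤ-* i j = begin
    fromℤ (i ℤ.* j)
      ≈⟨ fromℤ-◃ (ℤ.sign i Sign.* ℤ.sign j) (ℤ.∣ i ∣ ℕ.* ℤ.∣ j ∣) ⟩
    fromSign (ℤ.sign i Sign.* ℤ.sign j) * ((ℤ.∣ i ∣ ℕ.* ℤ.∣ j ∣) ×′ 1#)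
      ≈⟨ *-cong (fromSign-* (ℤ.sign i) (ℤ.sign j)) (×1-homo-* ℤ.∣ i ∣ ℤ.∣ j ∣) ⟩
    (fromSign (ℤ.sign i) * fromSign (ℤ.sign j)) * ((ℤ.∣ i ∣ ×′ 1#) * (ℤ.∣ j ∣ ×′ 1#))
      ≈⟨ interchange _ _ _ _ ⟩
    (fromSign (ℤ.sign i) * (ℤ.∣ i ∣ ×′ 1#)) * (fromSign (ℤ.sign j) * (ℤ.∣ j ∣ ×′ 1#))
      ≈⟨ *-cong (fromSign◃abs i) (fromSign◃abs j) ⟩
    fromℤ i * fromℤ j ∎

  fromℤ-neg : ∀ i → fromℤ (ℤ.- i) ≈ - fromℤ i
  fromℤ-neg -[1+ n ]  = sym (-‿involutive _)
  fromℤ-neg (+ zero)  = sym -0#≈0#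
  fromℤ-neg (+ suc n) = refl

  homomorphism : +-*-rawRing -Raw-AlmostCommutative⟶ fromCommutativeRing R
  homomorphism = record
    { ⟦_⟧ = fromℤ ; +-homo = fromℤ-+ ; *-homo = fromℤ-* ; -‿homo = fromℤ-neg
    ; 0-homo = refl ; 1-homo = refl }

  equal? : ∀ i j → Maybe (fromℤ i ≈ fromℤ j)
  equal? i j with i ℤ.≟ j
  ... | yes ≡.refl = just refl
  ... | no _       = nothing

  open import Algebra.Solver.Ring +-*-rawRing (fromCommutativeRing R) homomorphism equal? public

punchInℕ : ℕ → ℕ → ℕ
punchInℕ zero    k       = suc k
punchInℕ (suc j) zero    = zero
punchInℕ (suc j) (suc k) = suc (punchInℕ j k)

punchInℕ-bound : ∀ {n} j k → j < suc n → k < n → punchInℕ j k < suc n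
punchInℕ-bound zero    k       _         k<n       = s<s k<n
punchInℕ-bound (suc j) zero    _         _         = z<s
punchInℕ-bound (suc j) (suc k) (s<s j<n) (s<s k<n) = s<s (punchInℕ-bound j k j<n k<n)

toℕ-punchIn : ∀ {n} (j : Fin (suc n)) (k : Fin n) → toℕ (punchIn j k) ≡ punchInℕ (toℕ j) (toℕ k)
toℕ-punchIn         zero    k       = ≡.refl
toℕ-punchIn {suc n} (suc j) zero    = ≡.refl
toℕ-punchIn {suc n} (suc j) (suc k) = ≡.cong suc (toℕ-punchIn j k)

punchOutℕ : ℕ → ℕ → ℕ
punchOutℕ zero    k       = ℕ.pred k
punchOutℕ (suc j) zero    = zero
punchOutℕ (suc j) (suc k) = suc (punchOutℕ j k)

punchInℕ≢ : ∀ j k → punchInℕ j k ≢ j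
punchInℕ≢ zero    k       ()
punchInℕ≢ (suc j) zero    ()
punchInℕ≢ (suc j) (suc k) e = punchInℕ≢ j k (ℕₚ.suc-injective e)

punchInℕ-punchOutℕ : ∀ {j k} → k ≢ j → punchInℕ j (punchOutℕ j k) ≡ k
punchInℕ-punchOutℕ {zero}  {zero}  k≢j = contradiction ≡.refl k≢j
punchInℕ-punchOutℕ {zero}  {suc k} k≢j = ≡.refl
punchInℕ-punchOutℕ {suc j} {zero}  k≢j = ≡.refl
punchInℕ-punchOutℕ {suc j} {suc k} k≢j = ≡.cong suc (punchInℕ-punchOutℕ (k≢j ∘ ≡.cong suc))

punchOutℕ-punchInℕ : ∀ j k → punchOutℕ j (punchInℕ j k) ≡ k
punchOutℕ-punchInℕ zero    k       = ≡.refl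
punchOutℕ-punchInℕ (suc j) zero    = ≡.refl
punchOutℕ-punchInℕ (suc j) (suc k) = ≡.cong suc (punchOutℕ-punchInℕ j k)

punchOutℕ-< : ∀ {n j k} → k ≢ j → j < suc n → k < suc n → punchOutℕ j k < n
punchOutℕ-< {_}     {zero}  {zero}  k≢j _         _         = contradiction ≡.refl k≢j
punchOutℕ-< {_}     {zero}  {suc k} _   _         (s<s k<n) = k<n
punchOutℕ-< {zero}  {suc j} {zero}  _   (s<s ())  _
punchOutℕ-< {suc n} {suc j} {zero}  _   _         _         = z<s
punchOutℕ-< {suc n} {suc j} {suc k} k≢j (s<s j<n) (s<s k<n) = s<s (punchOutℕ-< (k≢j ∘ ≡.cong suc) j<n k<n)

punchOutℕ-suc : ∀ {j c} → j ≢ c → j ≢ suc c → punchOutℕ j (suc c) ≡ suc (punchOutℕ j c)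
punchOutℕ-suc {zero}        {zero}  j≢c _    = contradiction ≡.refl j≢c
punchOutℕ-suc {zero}        {suc c} _   _    = ≡.refl
punchOutℕ-suc {suc zero}    {zero}  _   j≢1+c = contradiction ≡.refl j≢1+c
punchOutℕ-suc {suc (suc j)} {zero}  _   _    = ≡.refl
punchOutℕ-suc {suc j}       {suc c} j≢c j≢1+c = ≡.cong suc (punchOutℕ-suc (j≢c ∘ ≡.cong suc) (j≢1+c ∘ ≡.cong suc))

punchInℕ-self : ∀ c → punchInℕ c c ≡ suc c
punchInℕ-self zero    = ≡.refl
punchInℕ-self (suc c) = ≡.cong suc (punchInℕ-self c)

punchInℕ-suc-self : ∀ c → punchInℕ (suc c) c ≡ c
punchInℕ-suc-self zero    = ≡.refl
punchInℕ-suc-self (suc c) = ≡.cong suc (punchInℕ-suc-self c)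

punchInℕ-suc : ∀ {c k} → k ≢ c → punchInℕ c k ≡ punchInℕ (suc c) k
punchInℕ-suc {zero}  {zero}  k≢c = contradiction ≡.refl k≢c
punchInℕ-suc {zero}  {suc k} _   = ≡.refl
punchInℕ-suc {suc c} {zero}  _   = ≡.refl
punchInℕ-suc {suc c} {suc k} k≢c = ≡.cong suc (punchInℕ-suc (k≢c ∘ ≡.cong suc))

punchInℕ-≥ : ∀ {j k} → j ≤ k → punchInℕ j k ≡ suc k
punchInℕ-≥ {zero}          _         = ≡.refl
punchInℕ-≥ {suc j} {suc k} (s≤s j≤k) = ≡.cong suc (punchInℕ-≥ j≤k)

punchInℕ-< : ∀ {j k} → k < j → punchInℕ j k ≡ k
punchInℕ-< {suc j} {zero}  _         = ≡.refl
punchInℕ-< {suc j} {suc k} (s<s k<j) = ≡.cong suc (punchInℕ-< k<j)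

∸-punchInℕ : ∀ {m j k} → j ≤ suc m → k < suc m → suc m ∸ punchInℕ j k ≡ punchInℕ (suc m ∸ j) (m ∸ k)
∸-punchInℕ {m}     {zero}  {k}     _         _         = ≡.sym (punchInℕ-< (s≤s (ℕₚ.m∸n≤m m k)))
∸-punchInℕ {m}     {suc j} {zero}  _         _         = ≡.sym (punchInℕ-≥ (ℕₚ.m∸n≤m m j))
∸-punchInℕ {suc m} {suc j} {suc k} (s≤s j≤m) (s<s k<m) = ∸-punchInℕ j≤m k<m

<ᵇ-true : ∀ {m n} → m < n → (m <ᵇ n) ≡ true
<ᵇ-true {m} {n} = dec-true (m ℕₚ.<? n)

<ᵇ-false : ∀ {m n} → ¬ m < n → (m <ᵇ n) ≡ false
<ᵇ-false {m} {n} = dec-false (m ℕₚ.<? n)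

≡ᵇ-true : ∀ {m n} → m ≡ n → (m ≡ᵇ n) ≡ true
≡ᵇ-true {m} {n} = dec-true (m ℕ.≟ n)

≡ᵇ-false : ∀ {m n} → m ≢ n → (m ≡ᵇ n) ≡ false
≡ᵇ-false {m} {n} = dec-false (m ℕ.≟ n)

<ᵇ-suc : ∀ {k r} → k ≢ r → (k <ᵇ suc r) ≡ (k <ᵇ r)
<ᵇ-suc {k} {r} k≢r with k ℕₚ.<? r
... | yes k<r = ≡.trans (<ᵇ-true (ℕₚ.m<n⇒m<1+n k<r)) (≡.sym (<ᵇ-true k<r))
... | no  k≮r = ≡.trans (<ᵇ-false (λ k<1+r → k≮r (ℕₚ.≤∧≢⇒< (ℕₚ.≤-pred k<1+r) k≢r))) (≡.sym (<ᵇ-false k≮r))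

∸-≡ᵇ : ∀ {m i k} → i ≤ m → k ≤ m → ((m ∸ i) ≡ᵇ (m ∸ k)) ≡ (i ≡ᵇ k)
∸-≡ᵇ {m} {i} {k} i≤m k≤m with i ℕ.≟ k
... | yes ≡.refl = ≡.trans (≡ᵇ-true {m ∸ i} ≡.refl) (≡.sym (≡ᵇ-true {i} ≡.refl))
... | no i≢k     = ≡.trans (≡ᵇ-false (i≢k ∘ ℕₚ.∸-cancelˡ-≡ i≤m k≤m)) (≡.sym (≡ᵇ-false i≢k))

∸+∸+[+]≡+ : ∀ {m i k} → i ≤ m → k ≤ m → (m ∸ i) ℕ.+ (m ∸ k) ℕ.+ (i ℕ.+ k) ≡ m ℕ.+ m
∸+∸+[+]≡+ {m} {i} {k} i≤m k≤m =
  ≡.trans (+-interchange (m ∸ i) (m ∸ k) i k) (≡.cong₂ ℕ._+_ (ℕₚ.m∸n+n≡m i≤m) (ℕₚ.m∸n+n≡m k≤m))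
  where open import Algebra.Properties.CommutativeSemigroup ℕₚ.+-commutativeSemigroup using () renaming (interchange to +-interchange)

∸+∸-<ᵇ : ∀ {m i k} → i ≤ m → k ≤ m → ((m ∸ i) ℕ.+ (m ∸ k) <ᵇ suc m) ≡ not ((i ℕ.+ k) <ᵇ m)
∸+∸-<ᵇ {m} {i} {k} i≤m k≤m with (i ℕ.+ k) ℕₚ.<? m
... | yes i+k<m rewrite <ᵇ-true i+k<m =
  <ᵇ-false {(m ∸ i) ℕ.+ (m ∸ k)} {suc m} λ p<1+m →
    ℕₚ.<-irrefl (∸+∸+[+]≡+ i≤m k≤m) (ℕₚ.+-mono-≤-< (ℕₚ.≤-pred p<1+m) i+k<m)
... | no  i+k≮m rewrite <ᵇ-false i+k≮m =
  <ᵇ-true {(m ∸ i) ℕ.+ (m ∸ k)} {suc m} (s≤s (ℕₚ.≮⇒≥ λ m<p →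
    ℕₚ.<-irrefl (≡.sym (∸+∸+[+]≡+ i≤m k≤m)) (ℕₚ.+-mono-<-≤ m<p (ℕₚ.≮⇒≥ i+k≮m))))

module Determinant {c ℓ} (R : CommutativeRing c ℓ) where
  open CommutativeRing R hiding (zero)
  open CharPoly R using (sumFin; sign; det)
  open import Algebra.Properties.Ring ring using (-0#≈0#; -‿injective; -‿distribˡ-*)
  open import Relation.Binary.Reasoning.Setoid setoid
  open IntegerCoefficients R using (solve; _:=_; _:+_; _:*_; :-_; _:-_; con)

  -- Only the entries in [0, n)² of an n × n matrix matter; _≈[ n ]_ compares exactly those.
  Matrix : Set c
  Matrix = ℕ → ℕ → Carrier

  _≈[_]_ : Matrix → ℕ → Matrix → Set ℓ
  F ≈[ n ] G = ∀ i j → i < n → j < n → F i j ≈ G i j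

  ∑ : ℕ → (ℕ → Carrier) → Carrier
  ∑ zero    g = 0#
  ∑ (suc n) g = g 0 + ∑ n (λ j → g (suc j))

  ∑-cong : ∀ n {g h} → (∀ j → j < n → g j ≈ h j) → ∑ n g ≈ ∑ n h
  ∑-cong zero    _ = refl
  ∑-cong (suc n) p = +-cong (p 0 z<s) (∑-cong n (λ j q → p (suc j) (s<s q)))

  ∑-zero : ∀ n {g} → (∀ j → j < n → g j ≈ 0#) → ∑ n g ≈ 0#
  ∑-zero zero    _ = refl
  ∑-zero (suc n) p = trans (+-cong (p 0 z<s) (∑-zero n (λ j q → p (suc j) (s<s q)))) (+-identityʳ 0#)

  ∑-+ : ∀ n (g h : ℕ → Carrier) → ∑ n (λ j → g j + h j) ≈ ∑ n g + ∑ n h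
  ∑-+ zero    g h = sym (+-identityʳ 0#)
  ∑-+ (suc n) g h = trans (+-congˡ (∑-+ n _ _)) (+-interchange _ _ _ _)
    where open import Algebra.Properties.CommutativeSemigroup +-commutativeSemigroup using () renaming (interchange to +-interchange)

  *-distribˡ-∑ : ∀ n a (g : ℕ → Carrier) → a * ∑ n g ≈ ∑ n (λ j → a * g j)
  *-distribˡ-∑ zero    a g = zeroʳ a
  *-distribˡ-∑ (suc n) a g = trans (distribˡ _ _ _) (+-congˡ (*-distribˡ-∑ n a _))

  ∑-comm : ∀ n m (g : ℕ → ℕ → Carrier) → ∑ n (λ i → ∑ m (g i)) ≈ ∑ m (λ j → ∑ n (λ i → g i j))
  ∑-comm zero    m g = sym (∑-zero m (λ _ _ → refl))
  ∑-comm (suc n) m g = trans (+-congˡ (∑-comm n m (λ i → g (suc i)))) (sym (∑-+ m (g 0) _))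

  ∑-snoc : ∀ n (g : ℕ → Carrier) → ∑ (suc n) g ≈ ∑ n g + g n
  ∑-snoc zero    g = trans (+-identityʳ _) (sym (+-identityˡ _))
  ∑-snoc (suc n) g = trans (+-congˡ (∑-snoc n (λ j → g (suc j)))) (sym (+-assoc _ _ _))

  ∑-reverse : ∀ m (g : ℕ → Carrier) → ∑ (suc m) (λ j → g (m ∸ j)) ≈ ∑ (suc m) g
  ∑-reverse zero    g = refl
  ∑-reverse (suc m) g = begin
    g (suc m) + ∑ (suc m) (λ j → g (m ∸ j)) ≈⟨ +-congˡ (∑-reverse m g) ⟩
    g (suc m) + ∑ (suc m) g                 ≈⟨ +-comm _ _ ⟩
    ∑ (suc m) g + g (suc m)                 ≈⟨ ∑-snoc (suc m) g ⟨
    ∑ (suc (suc m)) g                       ∎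

  sign-+ : ∀ a b → sign (a ℕ.+ b) ≈ sign a * sign b
  sign-+ zero    b = sym (*-identityˡ _)
  sign-+ (suc a) b = trans (-‿cong (sign-+ a b)) (-‿distribˡ-* _ _)

  sign-square : ∀ k → sign k * sign k ≈ 1#
  sign-square zero    = *-identityˡ 1#
  sign-square (suc k) = trans (solve 1 (λ s → (:- s) :* (:- s) := s :* s) refl (sign k)) (sign-square k)

  sign-∸ : ∀ {m j} → j ≤ m → sign j ≈ sign m * sign (m ∸ j)
  sign-∸ {m} {j} j≤m = sym (begin
    sign m * sign (m ∸ j)                    ≡⟨ ≡.cong (λ k → sign k * sign (m ∸ j)) (ℕₚ.m∸n+n≡m j≤m) ⟨
    sign (m ∸ j ℕ.+ j) * sign (m ∸ j)        ≈⟨ *-congʳ (sign-+ (m ∸ j) j) ⟩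
    (sign (m ∸ j) * sign j) * sign (m ∸ j)   ≈⟨ solve 2 (λ s t → (s :* t) :* s := t :* (s :* s)) refl (sign (m ∸ j)) (sign j) ⟩
    sign j * (sign (m ∸ j) * sign (m ∸ j))   ≈⟨ *-congˡ (sign-square (m ∸ j)) ⟩
    sign j * 1#                              ≈⟨ *-identityʳ _ ⟩
    sign j                                   ∎)

  minor : ℕ → Matrix → Matrix
  minor j F i k = F (suc i) (punchInℕ j k)

  detℕ : ℕ → Matrix → Carrier
  laplaceTerm : ℕ → Matrix → ℕ → Carrier

  detℕ zero    F = 1#
  detℕ (suc n) F = ∑ (suc n) (laplaceTerm n F)

  laplaceTerm n F j = sign j * (F 0 j * detℕ n (minor j F))

  laplaceTerm-entry≈0 : ∀ n F j → F 0 j ≈ 0# → laplaceTerm n F j ≈ 0#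
  laplaceTerm-entry≈0 n F j F0j≈0 = trans (*-congˡ (trans (*-congʳ F0j≈0) (zeroˡ _))) (zeroʳ _)

  laplaceTerm-minor≈0 : ∀ n F j → detℕ n (minor j F) ≈ 0# → laplaceTerm n F j ≈ 0#
  laplaceTerm-minor≈0 n F j minor≈0 = trans (*-congˡ (trans (*-congˡ minor≈0) (zeroʳ _))) (zeroʳ _)

  detℕ-cong : ∀ n {F G} → F ≈[ n ] G → detℕ n F ≈ detℕ n G
  detℕ-cong zero    p = refl
  detℕ-cong (suc n) {F} {G} p = ∑-cong (suc n) {laplaceTerm n F} {laplaceTerm n G} λ j j<n →
    *-congˡ (*-cong (p 0 j z<s j<n)
      (detℕ-cong n (λ i k i<n k<n → p (suc i) (punchInℕ j k) (s<s i<n) (punchInℕ-bound j k j<n k<n))))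

  sumFin≈∑ : ∀ n (g : Fin n → Carrier) h → (∀ j → g j ≈ h (toℕ j)) → sumFin n g ≈ ∑ n h
  sumFin≈∑ zero    g h p = refl
  sumFin≈∑ (suc n) g h p = +-cong (p zero) (sumFin≈∑ n _ _ (λ j → p (suc j)))

  det≈detℕ : ∀ n (M : Fin n → Fin n → Carrier) (F : Matrix) →
             (∀ i j → M i j ≈ F (toℕ i) (toℕ j)) → det n M ≈ detℕ n F
  det≈detℕ zero    M F p = refl
  det≈detℕ (suc n) M F p = sumFin≈∑ (suc n) _ (laplaceTerm n F) λ j →
    *-congˡ (*-cong (p zero j) (det≈detℕ n _ (minor (toℕ j) F) λ i k →
      trans (p (suc i) (punchIn j k)) (reflexive (≡.cong (F (suc (toℕ i))) (toℕ-punchIn j k)))))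

  setRow₀ : (ℕ → Carrier) → Matrix → Matrix
  setRow₀ u F zero    j = u j
  setRow₀ u F (suc i) j = F (suc i) j

  detℕ-row₀-linear : ∀ n (u v : ℕ → Carrier) F →
    detℕ (suc n) (setRow₀ (λ j → u j + v j) F) ≈ detℕ (suc n) (setRow₀ u F) + detℕ (suc n) (setRow₀ v F)
  detℕ-row₀-linear n u v F =
    trans (∑-cong (suc n) λ j _ → split j) (∑-+ (suc n) (laplaceTerm n (setRow₀ u F)) (laplaceTerm n (setRow₀ v F)))
    where
    split : ∀ j → sign j * ((u j + v j) * detℕ n (minor j F))
                ≈ sign j * (u j * detℕ n (minor j F)) + sign j * (v j * detℕ n (minor j F))
    split j = trans (*-congˡ (distribʳ _ _ _)) (distribˡ _ _ _)

  detℕ-row₀-e₀ : ∀ n F → (∀ j → j < n → F 0 (suc j) ≈ 0#) → detℕ (suc n) F ≈ F 0 0 * detℕ n (minor 0 F)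
  detℕ-row₀-e₀ n F row₀ = begin
    1# * (F 0 0 * detℕ n (minor 0 F)) + ∑ n (λ j → laplaceTerm n F (suc j)) ≈⟨ +-cong (*-identityˡ _) (∑-zero n vanish) ⟩
    F 0 0 * detℕ n (minor 0 F) + 0#                                         ≈⟨ +-identityʳ _ ⟩
    F 0 0 * detℕ n (minor 0 F)                                              ∎
    where
    vanish : ∀ j → j < n → laplaceTerm n F (suc j) ≈ 0#
    vanish j j<n = laplaceTerm-entry≈0 n F (suc j) (row₀ j j<n)

  detℕ-zeroColumn₀ : ∀ n F → (∀ i → i < suc n → F i 0 ≈ 0#) → detℕ (suc n) F ≈ 0#
  detℕ-zeroColumn₀ n F col₀ = trans (+-cong (laplaceTerm-entry≈0 n F 0 (col₀ 0 z<s)) (∑-zero n rest)) (+-identityʳ 0#)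
    where
    rest : ∀ j → j < n → laplaceTerm n F (suc j) ≈ 0#
    rest j (s<s {n = n′} _) = laplaceTerm-minor≈0 (suc n′) F (suc j)
      (detℕ-zeroColumn₀ n′ (minor (suc j) F) (λ i i<n → col₀ (suc i) (s<s i<n)))

  detℕ-column₀-e₀ : ∀ n F → (∀ i → i < n → F (suc i) 0 ≈ 0#) → detℕ (suc n) F ≈ F 0 0 * detℕ n (minor 0 F)
  detℕ-column₀-e₀ n F col₀ = trans (+-cong (*-identityˡ _) (∑-zero n rest)) (+-identityʳ _)
    where
    rest : ∀ j → j < n → laplaceTerm n F (suc j) ≈ 0#
    rest j (s<s {n = n′} _) = laplaceTerm-minor≈0 (suc n′) F (suc j)
      (detℕ-zeroColumn₀ n′ (minor (suc j) F) col₀)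

  -- Expand along the first row; the second minor then has first column (F 1 0, 0, …, 0).
  detℕ-tridiagonal : ∀ n F → (∀ j → F 0 (suc (suc j)) ≈ 0#) → (∀ i → F (suc (suc i)) 0 ≈ 0#) →
    detℕ (suc (suc n)) F ≈ F 0 0 * detℕ (suc n) (minor 0 F) - (F 0 1 * F 1 0) * detℕ n (minor 0 (minor 0 F))
  detℕ-tridiagonal n F row₀ col₀ = begin
    detℕ (suc (suc n)) F
      ≈⟨ +-congˡ (+-cong (*-congˡ (*-congˡ (detℕ-column₀-e₀ n G (λ i _ → col₀ i))))
                         (∑-zero n (λ j _ → laplaceTerm-entry≈0 (suc n) F (suc (suc j)) (row₀ j)))) ⟩
    1# * (F 0 0 * detℕ (suc n) (minor 0 F)) + (- 1# * (F 0 1 * (F 1 0 * detℕ n (minor 0 G))) + 0#)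
      ≈⟨ solve 5 (λ a b c D₁ D₀ → con (+ 1) :* (a :* D₁) :+ ((:- con (+ 1)) :* (b :* (c :* D₀)) :+ con (+ 0))
                                  := a :* D₁ :- (b :* c) :* D₀) refl _ _ _ _ _ ⟩
    F 0 0 * detℕ (suc n) (minor 0 F) - (F 0 1 * F 1 0) * detℕ n (minor 0 G) ∎
    where
    G : Matrix
    G = minor 1 F

  detℕ-column-linear : ∀ n c (F G H : Matrix) a b → c < n →
    (∀ i → i < n → F i c ≈ a * G i c + b * H i c) →
    (∀ i k → i < n → k < n → k ≢ c → F i k ≈ G i k) →
    (∀ i k → i < n → k < n → k ≢ c → F i k ≈ H i k) →
    detℕ n F ≈ a * detℕ n G + b * detℕ n H
  detℕ-column-linear (suc n) c F G H a b c<n colᶜ Fᴳ Fᴴ =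
    trans (∑-cong (suc n) {laplaceTerm n F} term) (∑-linear (laplaceTerm n G) (laplaceTerm n H))
    where
    ∑-linear : ∀ g h → ∑ (suc n) (λ j → a * g j + b * h j) ≈ a * ∑ (suc n) g + b * ∑ (suc n) h
    ∑-linear g h = trans (∑-+ (suc n) (λ j → a * g j) (λ j → b * h j))
                         (sym (+-cong (*-distribˡ-∑ (suc n) a g) (*-distribˡ-∑ (suc n) b h)))

    linear-entry : ∀ s x y z D → x ≈ a * y + b * z → s * (x * D) ≈ a * (s * (y * D)) + b * (s * (z * D))
    linear-entry s x y z D x≈ = trans (*-congˡ (*-congʳ x≈))
      (solve 6 (λ s y z a b D → s :* ((a :* y :+ b :* z) :* D) := a :* (s :* (y :* D)) :+ b :* (s :* (z :* D))) refl s y z a b D)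

    linear-minor : ∀ s x D D′ D″ → D ≈ a * D′ + b * D″ → s * (x * D) ≈ a * (s * (x * D′)) + b * (s * (x * D″))
    linear-minor s x D D′ D″ D≈ = trans (*-congˡ (*-congˡ D≈))
      (solve 6 (λ s x a b D′ D″ → s :* (x :* (a :* D′ :+ b :* D″)) := a :* (s :* (x :* D′)) :+ b :* (s :* (x :* D″)))
               refl s x a b D′ D″)

    term : ∀ j → j < suc n → laplaceTerm n F j ≈ a * laplaceTerm n G j + b * laplaceTerm n H j
    term j j<n with j ℕ.≟ c
    ... | yes ≡.refl = trans (linear-entry _ _ _ _ _ (colᶜ 0 z<s))
            (+-cong (*-congˡ (*-congˡ (*-congˡ (detℕ-cong n (sameMinor Fᴳ)))))
                    (*-congˡ (*-congˡ (*-congˡ (detℕ-cong n (sameMinor Fᴴ))))))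
      where
      sameMinor : ∀ {G′} → (∀ i k → i < suc n → k < suc n → k ≢ j → F i k ≈ G′ i k) → minor j F ≈[ n ] minor j G′
      sameMinor Fᴳ′ i k i<n k<n = Fᴳ′ (suc i) (punchInℕ j k) (s<s i<n) (punchInℕ-bound j k j<n k<n) (punchInℕ≢ j k)
    ... | no j≢c = trans
            (linear-minor _ _ _ _ _
              (detℕ-column-linear n c′ (minor j F) (minor j G) (minor j H) a b c′<n colᶜ′ (minorᴳ Fᴳ) (minorᴳ Fᴴ)))
            (+-cong (*-congˡ (*-congˡ (*-congʳ (Fᴳ 0 j z<s j<n j≢c)))) (*-congˡ (*-congˡ (*-congʳ (Fᴴ 0 j z<s j<n j≢c)))))
      where
      c′ : ℕ
      c′ = punchOutℕ j c
      c≢j : c ≢ j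
      c≢j = j≢c ∘ ≡.sym
      c′<n : c′ < n
      c′<n = punchOutℕ-< c≢j j<n c<n
      colᶜ′ : ∀ i → i < n → minor j F i c′ ≈ a * minor j G i c′ + b * minor j H i c′
      colᶜ′ i i<n rewrite punchInℕ-punchOutℕ c≢j = colᶜ (suc i) (s<s i<n)
      minorᴳ : ∀ {G′} → (∀ i k → i < suc n → k < suc n → k ≢ c → F i k ≈ G′ i k) →
               ∀ i k → i < n → k < n → k ≢ c′ → minor j F i k ≈ minor j G′ i k
      minorᴳ Fᴳ′ i k i<n k<n k≢c′ = Fᴳ′ (suc i) (punchInℕ j k) (s<s i<n) (punchInℕ-bound j k j<n k<n)
        (λ e → k≢c′ (≡.trans (≡.sym (punchOutℕ-punchInℕ j k)) (≡.cong (punchOutℕ j) e)))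

  ∑-cancellingPair : ∀ n c (g : ℕ → Carrier) → suc c < n → g c + g (suc c) ≈ 0# →
                     (∀ j → j < n → j ≢ c → j ≢ suc c → g j ≈ 0#) → ∑ n g ≈ 0#
  ∑-cancellingPair (suc (suc n)) zero g _ pair rest =
    trans (sym (+-assoc _ _ _)) (trans (+-cong pair (∑-zero n (λ j j<n → rest (suc (suc j)) (s<s (s<s j<n)) (λ ()) (λ ())))) (+-identityʳ 0#))
  ∑-cancellingPair (suc n) (suc c) g (s<s c<n) pair rest =
    trans (+-cong (rest 0 z<s (λ ()) (λ ())) (∑-cancellingPair n c (λ j → g (suc j)) c<n pair
            (λ j j<n j≢c j≢1+c → rest (suc j) (s<s j<n) (j≢c ∘ ℕₚ.suc-injective) (j≢1+c ∘ ℕₚ.suc-injective))))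
          (+-identityˡ 0#)

  -- The expansion terms at columns c and c + 1 cancel, and every other minor again has two
  -- equal adjacent columns.
  detℕ-equalAdjacentColumns : ∀ n c F → suc c < n → (∀ i → i < n → F i c ≈ F i (suc c)) → detℕ n F ≈ 0#
  detℕ-equalAdjacentColumns (suc n) c F c<n cols = ∑-cancellingPair (suc n) c (laplaceTerm n F) c<n pair others
    where
    minors : detℕ n (minor c F) ≈ detℕ n (minor (suc c) F)
    minors = detℕ-cong n λ i k i<n _ → entry i k (s<s i<n)
      where
      entry : ∀ i k → suc i < suc n → F (suc i) (punchInℕ c k) ≈ F (suc i) (punchInℕ (suc c) k)
      entry i k i<n with k ℕ.≟ c
      ... | yes ≡.refl rewrite punchInℕ-self k | punchInℕ-suc-self k = sym (cols (suc i) i<n)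
      ... | no k≢c = reflexive (≡.cong (F (suc i)) (punchInℕ-suc k≢c))
    pair : laplaceTerm n F c + laplaceTerm n F (suc c) ≈ 0#
    pair = trans (+-congˡ (*-congˡ (*-cong (sym (cols 0 z<s)) (sym minors))))
      (solve 3 (λ s a D → s :* (a :* D) :+ (:- s) :* (a :* D) := con (+ 0)) refl (sign c) (F 0 c) _)
    others : ∀ j → j < suc n → j ≢ c → j ≢ suc c → laplaceTerm n F j ≈ 0#
    others j j<n j≢c j≢1+c = laplaceTerm-minor≈0 n F j
      (detℕ-equalAdjacentColumns n (punchOutℕ j c) (minor j F) bound minorCols)
      where
      c′≡ : punchOutℕ j (suc c) ≡ suc (punchOutℕ j c)
      c′≡ = punchOutℕ-suc j≢c j≢1+c
      bound : suc (punchOutℕ j c) < n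
      bound = ≡.subst (_< n) c′≡ (punchOutℕ-< (j≢1+c ∘ ≡.sym) j<n c<n)
      minorCols : ∀ i → i < n → minor j F i (punchOutℕ j c) ≈ minor j F i (suc (punchOutℕ j c))
      minorCols i i<n rewrite ≡.sym c′≡ | punchInℕ-punchOutℕ (j≢c ∘ ≡.sym) | punchInℕ-punchOutℕ (j≢1+c ∘ ≡.sym) =
        cols (suc i) (s<s i<n)

  detℕ-column-additive : ∀ n c (F G H : Matrix) → c < n →
    (∀ i → i < n → F i c ≈ G i c + H i c) →
    (∀ i k → i < n → k < n → k ≢ c → F i k ≈ G i k) →
    (∀ i k → i < n → k < n → k ≢ c → F i k ≈ H i k) →
    detℕ n F ≈ detℕ n G + detℕ n H
  detℕ-column-additive n c F G H c<n colᶜ Fᴳ Fᴴ =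
    trans (detℕ-column-linear n c F G H 1# 1# c<n
             (λ i i<n → trans (colᶜ i i<n) (+-cong (sym (*-identityˡ _)) (sym (*-identityˡ _)))) Fᴳ Fᴴ)
          (+-cong (*-identityˡ _) (*-identityˡ _))

  replaceColumns : ℕ → ℕ → (ℕ → Carrier) → (ℕ → Carrier) → Matrix → Matrix
  replaceColumns a b u v F i k with k ℕ.≟ a | k ℕ.≟ b
  ... | yes _ | _     = u i
  ... | no _  | yes _ = v i
  ... | no _  | no _  = F i k

  module ReplaceColumns {a b : ℕ} {F : Matrix} where

    replaceColumns-a : ∀ {u v i} → replaceColumns a b u v F i a ≡ u i
    replaceColumns-a {i = i} with a ℕ.≟ a
    ... | yes _   = ≡.refl
    ... | no a≢a  = contradiction ≡.refl a≢a

    replaceColumns-b : ∀ {u v i} → a ≢ b → replaceColumns a b u v F i b ≡ v i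
    replaceColumns-b a≢b with b ℕ.≟ a | b ℕ.≟ b
    ... | yes b≡a | _      = contradiction (≡.sym b≡a) a≢b
    ... | no _    | yes _  = ≡.refl
    ... | no _    | no b≢b = contradiction ≡.refl b≢b

    replaceColumns-≢a : ∀ {u u′ v i k} → k ≢ a → replaceColumns a b u v F i k ≡ replaceColumns a b u′ v F i k
    replaceColumns-≢a {k = k} k≢a with k ℕ.≟ a | k ℕ.≟ b
    ... | yes k≡a | _     = contradiction k≡a k≢a
    ... | no _    | yes _ = ≡.refl
    ... | no _    | no _  = ≡.refl

    replaceColumns-≢b : ∀ {u v v′ i k} → k ≢ b → replaceColumns a b u v F i k ≡ replaceColumns a b u v′ F i k
    replaceColumns-≢b {k = k} k≢b with k ℕ.≟ a | k ℕ.≟ b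
    ... | yes _ | _       = ≡.refl
    ... | no _  | yes k≡b = contradiction k≡b k≢b
    ... | no _  | no _    = ≡.refl

    replaceColumns-elsewhere : ∀ {u v i k} → k ≢ a → k ≢ b → replaceColumns a b u v F i k ≡ F i k
    replaceColumns-elsewhere {k = k} k≢a k≢b with k ℕ.≟ a | k ℕ.≟ b
    ... | yes k≡a | _       = contradiction k≡a k≢a
    ... | no _    | yes k≡b = contradiction k≡b k≢b
    ... | no _    | no _    = ≡.refl

    replaceColumns-id : ∀ i k → replaceColumns a b (λ i → F i a) (λ i → F i b) F i k ≡ F i k
    replaceColumns-id i k with k ℕ.≟ a | k ℕ.≟ b
    ... | yes ≡.refl | _          = ≡.refl
    ... | no _       | yes ≡.refl = ≡.refl
    ... | no _       | no _       = ≡.refl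

  swapColumns : ℕ → ℕ → Matrix → Matrix
  swapColumns a b F = replaceColumns a b (λ i → F i b) (λ i → F i a) F

  -- Bilinearity in the two columns: 0 = E(u+v, u+v) = E(u, v) + E(v, u).
  detℕ-swapColumns : ∀ n a b F → a < n → b < n → a ≢ b →
    (∀ G → (∀ i → i < n → G i a ≈ G i b) → detℕ n G ≈ 0#) →
    detℕ n (swapColumns a b F) ≈ - detℕ n F
  detℕ-swapColumns n a b F a<n b<n a≢b alternating = begin
    E V U                ≈⟨ solve 4 (λ p q r t → r := ((p :+ q) :+ (r :+ t) :- p :- t) :- q) refl (E U U) (E U V) (E V U) (E V V) ⟩
    ((E U U + E U V) + (E V U + E V V) - E U U - E V V) - E U V
      ≈⟨ +-congʳ (+-cong (+-cong expand (-‿cong (E-diagonal U))) (-‿cong (E-diagonal V))) ⟩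
    ((0# - 0#) - 0#) - E U V ≈⟨ solve 1 (λ q → ((con (+ 0) :- con (+ 0)) :- con (+ 0)) :- q := :- q) refl (E U V) ⟩
    - E U V              ≈⟨ -‿cong (detℕ-cong n (λ i k _ _ → reflexive (replaceColumns-id i k))) ⟩
    - detℕ n F           ∎
    where
    open ReplaceColumns {a} {b} {F}
    U V : ℕ → Carrier
    U i = F i a
    V i = F i b
    E : (ℕ → Carrier) → (ℕ → Carrier) → Carrier
    E u v = detℕ n (replaceColumns a b u v F)
    E-diagonal : ∀ u → E u u ≈ 0#
    E-diagonal u = alternating _ (λ i _ → reflexive (≡.trans replaceColumns-a (≡.sym (replaceColumns-b a≢b))))
    additiveˡ : ∀ u v w → E (λ i → u i + v i) w ≈ E u w + E v w
    additiveˡ u v w = detℕ-column-additive n a _ _ _ a<n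
      (λ i _ → reflexive (≡.trans replaceColumns-a (≡.sym (≡.cong₂ _+_ replaceColumns-a replaceColumns-a))))
      (λ i k _ _ k≢a → reflexive (replaceColumns-≢a k≢a))
      (λ i k _ _ k≢a → reflexive (replaceColumns-≢a k≢a))
    additiveʳ : ∀ u v w → E w (λ i → u i + v i) ≈ E w u + E w v
    additiveʳ u v w = detℕ-column-additive n b _ _ _ b<n
      (λ i _ → reflexive (≡.trans (replaceColumns-b a≢b) (≡.sym (≡.cong₂ _+_ (replaceColumns-b a≢b) (replaceColumns-b a≢b)))))
      (λ i k _ _ k≢b → reflexive (replaceColumns-≢b k≢b))
      (λ i k _ _ k≢b → reflexive (replaceColumns-≢b k≢b))
    UV : ℕ → Carrier
    UV i = U i + V i
    expand : (E U U + E U V) + (E V U + E V V) ≈ 0#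
    expand = trans (sym (trans (additiveˡ U V UV) (+-cong (additiveʳ U V U) (additiveʳ U V V)))) (E-diagonal UV)

  -- Shorten the distance between the equal columns by an adjacent transposition, which only flips the sign.
  detℕ-equalColumns : ∀ n a b F → a < b → b < n → (∀ i → i < n → F i a ≈ F i b) → detℕ n F ≈ 0#
  detℕ-equalColumns n a b F a<b b<n cols =
    atDistance (b ∸ suc a) F (≡.subst (_< n) (≡.sym b≡) b<n)
      (λ i i<n → ≡.subst (λ k → F i a ≈ F i k) (≡.sym b≡) (cols i i<n))
    where
    b≡ : b ∸ suc a ℕ.+ suc a ≡ b
    b≡ = ℕₚ.m∸n+n≡m a<b
    atDistance : ∀ d F → d ℕ.+ suc a < n → (∀ i → i < n → F i a ≈ F i (d ℕ.+ suc a)) → detℕ n F ≈ 0#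
    atDistance zero    F b<n cols = detℕ-equalAdjacentColumns n a F b<n cols
    atDistance (suc d) F b<n cols = -‿injective (trans (sym swapped) (trans (atDistance d F′ p<n cols′) (sym -0#≈0#)))
      where
      open ReplaceColumns {d ℕ.+ suc a} {suc (d ℕ.+ suc a)} {F}
      p : ℕ
      p = d ℕ.+ suc a
      p<n : p < n
      p<n = ℕₚ.<-trans (ℕₚ.n<1+n p) b<n
      F′ : Matrix
      F′ = swapColumns p (suc p) F
      swapped : detℕ n F′ ≈ - detℕ n F
      swapped = detℕ-swapColumns n p (suc p) F p<n b<n (ℕₚ.1+n≢n ∘ ≡.sym) (λ G → detℕ-equalAdjacentColumns n p G b<n)
      a<p : a < p
      a<p = ℕₚ.m≤n+m (suc a) d
      cols′ : ∀ i → i < n → F′ i a ≈ F′ i p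
      cols′ i i<n = trans (reflexive (replaceColumns-elsewhere (ℕₚ.<⇒≢ a<p) (ℕₚ.<⇒≢ (ℕₚ.m<n⇒m<1+n a<p))))
                          (trans (cols i i<n) (reflexive (≡.sym replaceColumns-a)))

  -- Expand each minor of the first-row expansion along its first column and exchange the two sums.
  detℕ-column₀-expansion : ∀ n F →
    detℕ (suc n) F ≈ ∑ (suc n) (λ i → sign i * (F i 0 * detℕ n (λ r k → F (punchInℕ i r) (suc k))))
  detℕ-column₀-expansion zero    F = refl
  detℕ-column₀-expansion (suc n) F = +-congˡ (begin
    ∑ (suc n) (λ j → sign (suc j) * (F 0 (suc j) * detℕ (suc n) (minor (suc j) F)))
      ≈⟨ ∑-cong (suc n) {λ j → laplaceTerm (suc n) F (suc j)}
                (λ j _ → *-congˡ (*-congˡ (detℕ-column₀-expansion n (minor (suc j) F)))) ⟩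
    ∑ (suc n) (λ j → sign (suc j) * (F 0 (suc j) * ∑ (suc n) (λ i → X i j)))
      ≈⟨ ∑-cong (suc n) (λ j _ → pushIn (sign (suc j)) (F 0 (suc j)) (λ i → X i j)) ⟩
    ∑ (suc n) (λ j → ∑ (suc n) (λ i → sign (suc j) * (F 0 (suc j) * X i j)))
      ≈⟨ ∑-comm (suc n) (suc n) (λ j i → sign (suc j) * (F 0 (suc j) * X i j)) ⟩
    ∑ (suc n) (λ i → ∑ (suc n) (λ j → sign (suc j) * (F 0 (suc j) * X i j)))
      ≈⟨ ∑-cong (suc n) (λ i _ → ∑-cong (suc n) (λ j _ → exchange (sign j) (F 0 (suc j)) (sign i) (F (suc i) 0) (D i j))) ⟩
    ∑ (suc n) (λ i → ∑ (suc n) (λ j → sign (suc i) * (F (suc i) 0 * Y i j)))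
      ≈⟨ ∑-cong (suc n) (λ i _ → pushIn (sign (suc i)) (F (suc i) 0) (λ j → Y i j)) ⟨
    ∑ (suc n) (λ i → sign (suc i) * (F (suc i) 0 * ∑ (suc n) (λ j → Y i j))) ∎)
    where
    D X Y : ℕ → ℕ → Carrier
    D i j = detℕ n (λ r k → F (suc (punchInℕ i r)) (suc (punchInℕ j k)))
    X i j = sign i * (F (suc i) 0 * D i j)
    Y i j = sign j * (F 0 (suc j) * D i j)
    pushIn : ∀ s a (g : ℕ → Carrier) → s * (a * ∑ (suc n) g) ≈ ∑ (suc n) (λ i → s * (a * g i))
    pushIn s a g = trans (*-congˡ (*-distribˡ-∑ (suc n) a g)) (*-distribˡ-∑ (suc n) s (λ i → a * g i))
    exchange : ∀ sj a si b D → (- sj) * (a * (si * (b * D))) ≈ (- si) * (b * (sj * (a * D)))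
    exchange = solve 5 (λ sj a si b D → (:- sj) :* (a :* (si :* (b :* D))) := (:- si) :* (b :* (sj :* (a :* D)))) refl

  detℕ-transpose : ∀ n F → detℕ n (λ i j → F j i) ≈ detℕ n F
  detℕ-transpose zero    F = refl
  detℕ-transpose (suc n) F =
    trans (∑-cong (suc n) {laplaceTerm n (λ i j → F j i)}
             (λ j _ → *-congˡ (*-congˡ (detℕ-transpose n (λ r k → F (punchInℕ j r) (suc k))))))
          (sym (detℕ-column₀-expansion n F))

  detℕ-neg : ∀ n F → detℕ n (λ i j → - F i j) ≈ sign n * detℕ n F
  detℕ-neg zero    F = sym (*-identityˡ 1#)
  detℕ-neg (suc n) F = trans
    (∑-cong (suc n) {laplaceTerm n (λ i j → - F i j)} (λ j _ → trans (*-congˡ (*-congˡ (detℕ-neg n (minor j F)))) (pullOut _ _ _ _)))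
    (sym (*-distribˡ-∑ (suc n) (- sign n) (laplaceTerm n F)))
    where
    pullOut : ∀ sj a sn D → sj * (- a * (sn * D)) ≈ (- sn) * (sj * (a * D))
    pullOut = solve 4 (λ sj a sn D → sj :* ((:- a) :* (sn :* D)) := (:- sn) :* (sj :* (a :* D))) refl

  detℕ-lastRowColumn : ∀ n F → (∀ i → i < n → F i n ≈ 0#) → (∀ j → j < n → F n j ≈ 0#) →
                       detℕ (suc n) F ≈ F n n * detℕ n F
  detℕ-lastRowColumn zero    F _   _   = trans (+-identityʳ _) (*-identityˡ _)
  detℕ-lastRowColumn (suc n) F col row = begin
    detℕ (suc (suc n)) F
      ≈⟨ ∑-snoc (suc n) (laplaceTerm (suc n) F) ⟩
    ∑ (suc n) (laplaceTerm (suc n) F) + laplaceTerm (suc n) F (suc n)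
      ≈⟨ +-cong (∑-cong (suc n) term) (laplaceTerm-entry≈0 (suc n) F (suc n) (col 0 z<s)) ⟩
    ∑ (suc n) (λ j → F (suc n) (suc n) * laplaceTerm n F j) + 0#     ≈⟨ +-identityʳ _ ⟩
    ∑ (suc n) (λ j → F (suc n) (suc n) * laplaceTerm n F j)          ≈⟨ *-distribˡ-∑ (suc n) (F (suc n) (suc n)) (laplaceTerm n F) ⟨
    F (suc n) (suc n) * detℕ (suc n) F                               ∎
    where
    term : ∀ j → j < suc n → laplaceTerm (suc n) F j ≈ F (suc n) (suc n) * laplaceTerm n F j
    term j (s<s j≤n) = trans (*-congˡ (*-congˡ (trans
        (detℕ-lastRowColumn n (minor j F)
          (λ i i<n → ≡.subst (λ k → F (suc i) k ≈ 0#) (≡.sym (punchInℕ-≥ j≤n)) (col (suc i) (s<s i<n)))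
          (λ k k<n → row (punchInℕ j k) (punchInℕ-bound j k (s<s j≤n) k<n)))
        (*-congʳ (reflexive (≡.cong (F (suc n)) (punchInℕ-≥ j≤n)))))))
      (solve 4 (λ s a c D → s :* (a :* (c :* D)) := c :* (s :* (a :* D))) refl _ _ _ _)

  reversalSign : ℕ → Carrier
  reversalSign zero    = 1#
  reversalSign (suc m) = sign m * reversalSign m

  reversalSign-square : ∀ m → reversalSign m * reversalSign m ≈ 1#
  reversalSign-square zero    = *-identityˡ 1#
  reversalSign-square (suc m) = begin
    (sign m * reversalSign m) * (sign m * reversalSign m)   ≈⟨ solve 2 (λ s e → (s :* e) :* (s :* e) := (s :* s) :* (e :* e)) refl _ _ ⟩
    (sign m * sign m) * (reversalSign m * reversalSign m)   ≈⟨ *-cong (sign-square m) (reversalSign-square m) ⟩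
    1# * 1#                                                 ≈⟨ *-identityˡ 1# ⟩
    1#                                                      ∎

  -- In the first-row expansion of the reversed matrix the j-th minor is the reversed (m - j)-th minor.
  detℕ-reverseColumns : ∀ m F → detℕ (suc m) (λ i k → F i (m ∸ k)) ≈ reversalSign (suc m) * detℕ (suc m) F
  detℕ-reverseColumns zero    F = solve 1 (λ X → X := (con (+ 1) :* con (+ 1)) :* X) refl _
  detℕ-reverseColumns (suc m) F = begin
    ∑ (suc (suc m)) (laplaceTerm (suc m) G)                       ≈⟨ ∑-cong (suc (suc m)) term ⟩
    ∑ (suc (suc m)) (λ j → ε * laplaceTerm (suc m) F (suc m ∸ j))  ≈⟨ *-distribˡ-∑ (suc (suc m)) ε (λ j → laplaceTerm (suc m) F (suc m ∸ j)) ⟨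
    ε * ∑ (suc (suc m)) (λ j → laplaceTerm (suc m) F (suc m ∸ j))  ≈⟨ *-congˡ (∑-reverse (suc m) (laplaceTerm (suc m) F)) ⟩
    ε * detℕ (suc (suc m)) F                                       ∎
    where
    G : Matrix
    G i k = F i (suc m ∸ k)
    ε : Carrier
    ε = reversalSign (suc (suc m))
    term : ∀ j → j < suc (suc m) → laplaceTerm (suc m) G j ≈ ε * laplaceTerm (suc m) F (suc m ∸ j)
    term j (s≤s j≤1+m) = begin
      sign j * (F 0 (suc m ∸ j) * detℕ (suc m) (minor j G))
        ≈⟨ *-cong (sign-∸ j≤1+m) (*-congˡ (trans (detℕ-cong (suc m) minor≈) (detℕ-reverseColumns m (minor (suc m ∸ j) F)))) ⟩
      (sign (suc m) * s′) * (F 0 (suc m ∸ j) * (reversalSign (suc m) * D))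
        ≈⟨ solve 5 (λ s s′ a e D → (s :* s′) :* (a :* (e :* D)) := (s :* e) :* (s′ :* (a :* D))) refl _ _ _ _ _ ⟩
      ε * laplaceTerm (suc m) F (suc m ∸ j) ∎
      where
      s′ D : Carrier
      s′ = sign (suc m ∸ j)
      D  = detℕ (suc m) (minor (suc m ∸ j) F)
      minor≈ : minor j G ≈[ suc m ] (λ i k → minor (suc m ∸ j) F i (m ∸ k))
      minor≈ i k _ k<1+m = reflexive (≡.cong (F (suc i)) (∸-punchInℕ j≤1+m k<1+m))

  detℕ-reverse : ∀ m F → detℕ (suc m) (λ i k → F (m ∸ i) (m ∸ k)) ≈ detℕ (suc m) F
  detℕ-reverse m F = begin
    detℕ (suc m) (λ i k → F (m ∸ i) (m ∸ k))   ≈⟨ detℕ-reverseColumns m (λ i k → F (m ∸ i) k) ⟩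
    ε * detℕ (suc m) (λ i k → F (m ∸ i) k)     ≈⟨ *-congˡ (detℕ-transpose (suc m) (λ i k → F (m ∸ k) i)) ⟩
    ε * detℕ (suc m) (λ i k → F (m ∸ k) i)     ≈⟨ *-congˡ (detℕ-reverseColumns m (λ i k → F k i)) ⟩
    ε * (ε * detℕ (suc m) (λ i k → F k i))     ≈⟨ *-assoc ε ε _ ⟨
    (ε * ε) * detℕ (suc m) (λ i k → F k i)     ≈⟨ *-cong (reversalSign-square (suc m)) (detℕ-transpose (suc m) F) ⟩
    1# * detℕ (suc m) F                        ≈⟨ *-identityˡ _ ⟩
    detℕ (suc m) F                             ∎
    where
    ε : Carrier
    ε = reversalSign (suc m)

  subtractColumn₀ : ℕ → Matrix → Matrix
  subtractColumn₀ r F i zero    = F i 0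
  subtractColumn₀ r F i (suc k) = if k <ᵇ r then F i (suc k) - F i 0 else F i (suc k)

  detℕ-subtractColumn₀ : ∀ n r F → r < n → detℕ n (subtractColumn₀ r F) ≈ detℕ n F
  detℕ-subtractColumn₀ n zero    F _   = detℕ-cong n unchanged
    where
    unchanged : subtractColumn₀ 0 F ≈[ n ] F
    unchanged i zero    _ _ = refl
    unchanged i (suc k) _ _ = refl
  detℕ-subtractColumn₀ n (suc r) F r<n = begin
    detℕ n S′                         ≈⟨ detℕ-column-linear n (suc r) S′ S H 1# (- 1#) r<n column others others′ ⟩
    1# * detℕ n S + - 1# * detℕ n H    ≈⟨ +-cong (*-identityˡ _) (trans (*-congˡ H≈0) (zeroʳ _)) ⟩
    detℕ n S + 0#                     ≈⟨ +-identityʳ _ ⟩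
    detℕ n S                          ≈⟨ detℕ-subtractColumn₀ n r F (ℕₚ.<-trans (ℕₚ.n<1+n r) r<n) ⟩
    detℕ n F                          ∎
    where
    S S′ H : Matrix
    S  = subtractColumn₀ r F
    S′ = subtractColumn₀ (suc r) F
    H  = replaceColumns (suc r) (suc r) (λ i → F i 0) (λ i → F i 0) S
    open ReplaceColumns {suc r} {suc r} {S}
    H≈0 : detℕ n H ≈ 0#
    H≈0 = detℕ-equalColumns n 0 (suc r) H z<s r<n (λ i _ → reflexive (≡.sym replaceColumns-a))
    column : ∀ i → i < n → S′ i (suc r) ≈ 1# * S i (suc r) + - 1# * H i (suc r)
    column i _ rewrite <ᵇ-true (ℕₚ.n<1+n r) | <ᵇ-false (ℕₚ.<-irrefl (≡.refl {x = r}))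
                     | replaceColumns-a {u = λ i → F i 0} {v = λ i → F i 0} {i = i} =
      solve 2 (λ a b → a :- b := con (+ 1) :* a :+ (:- con (+ 1)) :* b) refl (F i (suc r)) (F i 0)
    others : ∀ i k → i < n → k < n → k ≢ suc r → S′ i k ≈ S i k
    others i zero    _ _ _      = refl
    others i (suc k) _ _ k≢1+r rewrite <ᵇ-suc (k≢1+r ∘ ≡.cong suc) = refl
    others′ : ∀ i k → i < n → k < n → k ≢ suc r → S′ i k ≈ H i k
    others′ i k i<n k<n k≢1+r = trans (others i k i<n k<n k≢1+r) (reflexive (≡.sym (replaceColumns-elsewhere k≢1+r k≢1+r)))

module CharacteristicMatrices {c ℓ} (R : CommutativeRing c ℓ) where
  open CommutativeRing R hiding (zero)
  open CharPoly R using (f; sign)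
  open Determinant R
  open IntegerCoefficients R using (solve; _:=_; _:+_; _:*_; :-_; _:-_; con)
  open import Relation.Binary.Reasoning.Setoid setoid

  χ : Bool → Carrier
  χ b = if b then 1# else 0#

  charMatrix : (ℕ → ℕ → Bool) → Carrier → Matrix
  charMatrix B x i j = x * χ (i ≡ᵇ j) - χ (B i j)

  x*0-0≈0 : ∀ x → x * 0# - 0# ≈ 0#
  x*0-0≈0 = solve 1 (λ x → x :* con (+ 0) :- con (+ 0) := con (+ 0)) refl

  f≈detℕ : ∀ n (B : BMat n) B′ x → (∀ i j → B i j ≡ B′ (toℕ i) (toℕ j)) → f n B x ≈ detℕ n (charMatrix B′ x)
  f≈detℕ n B B′ x B≡B′ = det≈detℕ n _ (charMatrix B′ x) λ i j → +-congˡ (-‿cong (reflexive (≡.cong χ (B≡B′ i j))))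

  T′ℕ Tℕ : ℕ → ℕ → Bool
  T′ℕ i j = ∣ i - j ∣ ≡ᵇ 1
  Tℕ zero zero = true
  Tℕ i    j    = T′ℕ i j

  f-T′ : ∀ n x → f n (T′ n) x ≈ detℕ n (charMatrix T′ℕ x)
  f-T′ n x = f≈detℕ n (T′ n) T′ℕ x λ _ _ → ≡.refl

  f-T : ∀ n x → f n (T n) x ≈ detℕ n (charMatrix Tℕ x)
  f-T n x = f≈detℕ n (T n) Tℕ x T≡Tℕ
    where
    T≡Tℕ : ∀ (i j : Fin n) → T n i j ≡ Tℕ (toℕ i) (toℕ j)
    T≡Tℕ zero    zero    = ≡.refl
    T≡Tℕ zero    (suc j) = ≡.refl
    T≡Tℕ (suc i) j       = ≡.refl

  P : Carrier → ℕ → Carrier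
  P x n = detℕ n (charMatrix T′ℕ x)

  -- minor 0 (charMatrix T′ℕ x) is definitionally charMatrix T′ℕ x again.
  P-recurrence : ∀ x n → P x (suc (suc n)) ≈ x * P x (suc n) - P x n
  P-recurrence x n = trans (detℕ-tridiagonal n (charMatrix T′ℕ x) (λ _ → x*0-0≈0 x) (λ _ → x*0-0≈0 x))
    (solve 3 (λ x P₁ P₀ → (x :* con (+ 1) :- con (+ 0)) :* P₁ :- ((x :* con (+ 0) :- con (+ 1)) :* (x :* con (+ 0) :- con (+ 1))) :* P₀
                        := x :* P₁ :- P₀) refl x (P x (suc n)) (P x n))

  P-one : ∀ x → P x 1 ≈ x * P x 0
  P-one = solve 1 (λ x → con (+ 1) :* ((x :* con (+ 1) :- con (+ 0)) :* con (+ 1)) :+ con (+ 0) := x :* con (+ 1)) refl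

  detℕ-Tℕ : ∀ x n → detℕ (suc n) (charMatrix Tℕ x) ≈ P x (suc n) - P x n
  detℕ-Tℕ x n = begin
    detℕ (suc n) (charMatrix Tℕ x)                               ≈⟨ detℕ-cong (suc n) split ⟩
    detℕ (suc n) (setRow₀ (λ j → F 0 j + e j) F)                 ≈⟨ detℕ-row₀-linear n (F 0) e F ⟩
    detℕ (suc n) (setRow₀ (F 0) F) + detℕ (suc n) (setRow₀ e F)
      ≈⟨ +-cong (detℕ-cong (suc n) unchanged) (detℕ-row₀-e₀ n (setRow₀ e F) (λ _ _ → refl)) ⟩
    P x (suc n) + - 1# * P x n                                   ≈⟨ +-congˡ (-1*x≈-x _) ⟩
    P x (suc n) - P x n                                          ∎
    where
    open import Algebra.Properties.Ring ring using (-1*x≈-x)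
    F : Matrix
    F = charMatrix T′ℕ x
    e : ℕ → Carrier
    e zero    = - 1#
    e (suc _) = 0#
    split : charMatrix Tℕ x ≈[ suc n ] setRow₀ (λ j → F 0 j + e j) F
    split zero    zero    _ _ = solve 1 (λ x → x :* con (+ 1) :- con (+ 1) := (x :* con (+ 1) :- con (+ 0)) :+ (:- con (+ 1))) refl x
    split zero    (suc j) _ _ = sym (+-identityʳ _)
    split (suc i) j       _ _ = refl
    unchanged : setRow₀ (F 0) F ≈[ suc n ] F
    unchanged zero    j _ _ = refl
    unchanged (suc i) j _ _ = refl

  module SineMultiples (x : Carrier) (s co : ℕ → Carrier)
    (s-suc  : ∀ k → s (suc k) ≈ s k * co 1 + co k * s 1)
    (co-suc : ∀ k → co (suc k) ≈ co k * co 1 - s k * s 1)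
    (pythagoras : s 1 * s 1 + co 1 * co 1 ≈ 1#) (co₁≈x : co 1 ≈ x) where

    s-recurrence : ∀ k → s (suc (suc k)) ≈ (x + x) * s (suc k) - s k
    s-recurrence k = begin
      s (suc (suc k))                                                        ≈⟨ s-suc (suc k) ⟩
      s (suc k) * co 1 + co (suc k) * s 1                                    ≈⟨ +-cong (*-congʳ (s-suc k)) (*-congʳ (co-suc k)) ⟩
      (s k * co 1 + co k * s 1) * co 1 + (co k * co 1 - s k * s 1) * s 1
        ≈⟨ solve 4 (λ a b c t → (a :* c :+ b :* t) :* c :+ (b :* c :- a :* t) :* t
                                := (c :+ c) :* (a :* c :+ b :* t) :- a :* (t :* t :+ c :* c)) refl _ _ _ _ ⟩
      (co 1 + co 1) * (s k * co 1 + co k * s 1) - s k * (s 1 * s 1 + co 1 * co 1)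
        ≈⟨ +-cong (*-cong (+-cong co₁≈x co₁≈x) (sym (s-suc k))) (-‿cong (trans (*-congˡ pythagoras) (*-identityʳ _))) ⟩
      (x + x) * s (suc k) - s k                                              ∎

    s₁*P≈s : ∀ n → s 1 * P (x + x) n ≈ s (suc n) × s 1 * P (x + x) (suc n) ≈ s (suc (suc n))
    s₁*P≈s zero = *-identityʳ _ , (begin
      s 1 * P (x + x) 1        ≈⟨ *-congˡ (trans (P-one (x + x)) (*-identityʳ _)) ⟩
      s 1 * (x + x)            ≈⟨ solve 2 (λ t x → t :* (x :+ x) := t :* x :+ x :* t) refl _ _ ⟩
      s 1 * x + x * s 1        ≈⟨ sym (trans (s-suc 1) (+-cong (*-congˡ co₁≈x) (*-congʳ co₁≈x))) ⟩
      s 2                      ∎)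
    s₁*P≈s (suc n) with s₁*P≈s n
    ... | sP₀ , sP₁ = sP₁ , (begin
      s 1 * P (x + x) (suc (suc n))                         ≈⟨ *-congˡ (P-recurrence (x + x) n) ⟩
      s 1 * ((x + x) * P (x + x) (suc n) - P (x + x) n)
        ≈⟨ solve 4 (λ t y p q → t :* (y :* p :- q) := y :* (t :* p) :- t :* q) refl _ _ _ _ ⟩
      (x + x) * (s 1 * P (x + x) (suc n)) - s 1 * P (x + x) n ≈⟨ +-cong (*-congˡ sP₁) (-‿cong sP₀) ⟩
      (x + x) * s (suc (suc n)) - s (suc n)                 ≈⟨ s-recurrence (suc n) ⟨
      s (suc (suc (suc n)))                                 ∎)

    s₁*[f-T′-f-T′]≈s-s : ∀ m → s 1 * (f (suc m) (T′ (suc m)) (x + x) - f m (T′ m) (x + x)) ≈ s (suc (suc m)) - s (suc m)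
    s₁*[f-T′-f-T′]≈s-s m = begin
      s 1 * (f (suc m) (T′ (suc m)) (x + x) - f m (T′ m) (x + x))
        ≈⟨ *-congˡ (+-cong (f-T′ (suc m) (x + x)) (-‿cong (f-T′ m (x + x)))) ⟩
      s 1 * (P (x + x) (suc m) - P (x + x) m)                     ≈⟨ x[y-z]≈xy-xz _ _ _ ⟩
      s 1 * P (x + x) (suc m) - s 1 * P (x + x) m                 ≈⟨ +-cong (proj₂ (s₁*P≈s m)) (-‿cong (proj₁ (s₁*P≈s m))) ⟩
      s (suc (suc m)) - s (suc m)                                 ∎
      where open import Algebra.Properties.Ring ring using (x[y-z]≈xy-xz)

  differences : (ℕ → Carrier) → ℕ → Carrier
  differences Q zero    = Q 0
  differences Q (suc k) = Q (suc k) - Q k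

  differences-recurrence : ∀ y (Q : ℕ → Carrier) → Q 1 ≈ y * Q 0 → (∀ n → Q (suc (suc n)) ≈ y * Q (suc n) - Q n) →
    ∀ m → differences Q (suc (suc m)) ≈ y * differences Q (suc m) - differences Q m
  differences-recurrence y Q Q₁ Q-rec zero = begin
    Q 2 - Q 1                     ≈⟨ +-cong (Q-rec 0) (-‿cong Q₁) ⟩
    (y * Q 1 - Q 0) - y * Q 0     ≈⟨ solve 3 (λ y q₁ q₀ → (y :* q₁ :- q₀) :- y :* q₀ := y :* (q₁ :- q₀) :- q₀) refl _ _ _ ⟩
    y * (Q 1 - Q 0) - Q 0         ∎
  differences-recurrence y Q Q₁ Q-rec (suc m) = begin
    Q (3 ℕ.+ m) - Q (2 ℕ.+ m)                         ≈⟨ +-cong (Q-rec (suc m)) (-‿cong (Q-rec m)) ⟩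
    (y * Q (2 ℕ.+ m) - Q (1 ℕ.+ m)) - (y * Q (1 ℕ.+ m) - Q m)
      ≈⟨ solve 4 (λ y a b c → (y :* a :- b) :- (y :* b :- c) := y :* (a :- b) :- (b :- c)) refl _ _ _ _ ⟩
    y * (Q (2 ℕ.+ m) - Q (1 ℕ.+ m)) - (Q (1 ℕ.+ m) - Q m) ∎

  f-T≈differences : ∀ x k → f k (T k) x ≈ differences (P x) k
  f-T≈differences x zero    = refl
  f-T≈differences x (suc k) = trans (f-T (suc k) x) (detℕ-Tℕ x k)

  f-T-recurrence : ∀ x m → f (suc (suc m)) (T (suc (suc m))) x ≈ x * f (suc m) (T (suc m)) x - f m (T m) x
  f-T-recurrence x m = begin
    f (suc (suc m)) (T (suc (suc m))) x                        ≈⟨ f-T≈differences x (suc (suc m)) ⟩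
    differences (P x) (suc (suc m))                            ≈⟨ differences-recurrence x (P x) (P-one x) (P-recurrence x) m ⟩
    x * differences (P x) (suc m) - differences (P x) m
      ≈⟨ +-cong (*-congˡ (f-T≈differences x (suc m))) (-‿cong (f-T≈differences x m)) ⟨
    x * f (suc m) (T (suc m)) x - f m (T m) x                  ∎

  f-T≈f-T′-f-T′ : ∀ x m → f (suc m) (T (suc m)) x ≈ f (suc m) (T′ (suc m)) x - f m (T′ m) x
  f-T≈f-T′-f-T′ x m = trans (f-T≈differences x (suc m)) (sym (+-cong (f-T′ (suc m) x) (-‿cong (f-T′ m x))))

  Aℕ : ℕ → ℕ → ℕ → Bool
  Aℕ n i j = (i ℕ.+ j) <ᵇ n

  f-A : ∀ n x → f n (A n) x ≈ detℕ n (charMatrix (Aℕ n) x)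
  f-A n x = f≈detℕ n (A n) (Aℕ n) x λ _ _ → ≡.refl

  module AntiTriangular (m : ℕ) (x : Carrier) where

    F F₁ K₁ : Matrix
    F  = charMatrix (Aℕ (suc (suc m))) x
    F₁ = setRow₀ (λ j → x * χ (0 ≡ᵇ j)) F
    K₁ = setRow₀ (λ _ → - 1#) F

    split : detℕ (suc (suc m)) F ≈ detℕ (suc (suc m)) F₁ + detℕ (suc (suc m)) K₁
    split = trans (detℕ-cong (suc (suc m)) row₀) (detℕ-row₀-linear (suc m) (λ j → x * χ (0 ≡ᵇ j)) (λ _ → - 1#) F)
      where
      row₀ : F ≈[ suc (suc m) ] setRow₀ (λ j → x * χ (0 ≡ᵇ j) + - 1#) F
      row₀ zero    j _ j<n rewrite <ᵇ-true j<n = refl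
      row₀ (suc i) j _ _   = refl

    xI-A : ℕ → Matrix
    xI-A k = charMatrix (Aℕ k) x

    detℕ-F₁ : detℕ (suc (suc m)) F₁ ≈ x * (x * detℕ m (xI-A m))
    detℕ-F₁ = begin
      detℕ (suc (suc m)) F₁                  ≈⟨ detℕ-row₀-e₀ (suc m) F₁ (λ _ _ → zeroʳ x) ⟩
      (x * 1#) * detℕ (suc m) N              ≈⟨ *-cong (*-identityʳ x) (detℕ-lastRowColumn m N column row) ⟩
      x * (N m m * detℕ m N)                 ≈⟨ *-congˡ (*-cong corner (detℕ-cong m shift)) ⟩
      x * (x * detℕ m (xI-A m))              ∎
      where
      N : Matrix
      N = minor 0 F
      column : ∀ i → i < m → N i m ≈ 0#
      column i i<m rewrite ≡ᵇ-false (ℕₚ.<⇒≢ i<m) | <ᵇ-false (ℕₚ.≤⇒≯ (ℕₚ.m≤n+m (suc m) i)) = x*0-0≈0 x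
      row : ∀ k → k < m → N m k ≈ 0#
      row k k<m rewrite ≡ᵇ-false (ℕₚ.<⇒≢ k<m ∘ ≡.sym) | <ᵇ-false {m ℕ.+ suc k} {suc m} (ℕₚ.≤⇒≯ (ℕₚ.m<m+n m z<s)) =
        x*0-0≈0 x
      corner : N m m ≈ x
      corner rewrite ≡ᵇ-true (≡.refl {x = m}) | <ᵇ-false {m ℕ.+ suc m} {suc m} (ℕₚ.≤⇒≯ (ℕₚ.m<m+n m z<s)) =
        solve 1 (λ x → x :* con (+ 1) :- con (+ 0) := x) refl x
      shift : N ≈[ m ] xI-A m
      shift i k _ _ = reflexive (≡.cong (λ b → x * χ (i ≡ᵇ k) - χ b) (≡.cong (_<ᵇ suc m) (ℕₚ.+-suc i k)))

    xI+A : Matrix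
    xI+A i k = x * χ (i ≡ᵇ k) + χ (Aℕ (suc m) i k)

    -- Subtracting the first column of K₁ from the others leaves the first row (-1, 0, …, 0) and,
    -- below it, xI + A conjugated by the reversal permutation.
    detℕ-K₁ : detℕ (suc (suc m)) K₁ ≈ - detℕ (suc m) xI+A
    detℕ-K₁ = begin
      detℕ (suc (suc m)) K₁                                   ≈⟨ detℕ-subtractColumn₀ (suc (suc m)) (suc m) K₁ ℕₚ.≤-refl ⟨
      detℕ (suc (suc m)) K₂                                   ≈⟨ detℕ-row₀-e₀ (suc m) K₂ row₀ ⟩
      - 1# * detℕ (suc m) (minor 0 K₂)                         ≈⟨ *-congˡ (detℕ-cong (suc m) reversed) ⟩
      - 1# * detℕ (suc m) (λ i k → xI+A (m ∸ i) (m ∸ k))       ≈⟨ *-congˡ (detℕ-reverse m xI+A) ⟩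
      - 1# * detℕ (suc m) xI+A                                 ≈⟨ -1*x≈-x _ ⟩
      - detℕ (suc m) xI+A                                      ∎
      where
      open import Algebra.Properties.Ring ring using (-1*x≈-x)
      K₂ : Matrix
      K₂ = subtractColumn₀ (suc m) K₁
      row₀ : ∀ j → j < suc m → K₂ 0 (suc j) ≈ 0#
      row₀ j j<1+m rewrite <ᵇ-true j<1+m = -‿inverseʳ (- 1#)
      entry : ∀ d b → (x * χ d - χ b) - (x * 0# - 1#) ≈ x * χ d + χ (not b)
      entry d true  = solve 2 (λ x e → (x :* e :- con (+ 1)) :- (x :* con (+ 0) :- con (+ 1)) := x :* e :+ con (+ 0)) refl x (χ d)
      entry d false = solve 2 (λ x e → (x :* e :- con (+ 0)) :- (x :* con (+ 0) :- con (+ 1)) := x :* e :+ con (+ 1)) refl x (χ d)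
      reversed : minor 0 K₂ ≈[ suc m ] (λ i k → xI+A (m ∸ i) (m ∸ k))
      reversed i k (s≤s i≤m) k<1+m@(s≤s k≤m)
        rewrite <ᵇ-true k<1+m | <ᵇ-true {i ℕ.+ 0} {suc m} (s≤s (≡.subst (_≤ m) (≡.sym (ℕₚ.+-identityʳ i)) i≤m))
              | ℕₚ.+-suc i k | ∸-≡ᵇ i≤m k≤m | ∸+∸-<ᵇ i≤m k≤m = entry (i ≡ᵇ k) ((i ℕ.+ k) <ᵇ m)

    f-A-neg : f (suc m) (A (suc m)) (- x) ≈ sign (suc m) * detℕ (suc m) xI+A
    f-A-neg = trans (f-A (suc m) (- x)) (trans (detℕ-cong (suc m) negated) (detℕ-neg (suc m) xI+A))
      where
      negated : charMatrix (Aℕ (suc m)) (- x) ≈[ suc m ] (λ i k → - xI+A i k)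
      negated i k _ _ = solve 3 (λ x d a → (:- x) :* d :- a := :- (x :* d :+ a)) refl x (χ (i ≡ᵇ k)) (χ (Aℕ (suc m) i k))

    f-A-recurrence : f (suc (suc m)) (A (suc (suc m))) x
                   ≈ (x * x) * f m (A m) x - sign (suc (suc (suc m))) * f (suc m) (A (suc m)) (- x)
    f-A-recurrence = begin
      f (suc (suc m)) (A (suc (suc m))) x                   ≈⟨ f-A (suc (suc m)) x ⟩
      detℕ (suc (suc m)) F                                  ≈⟨ split ⟩
      detℕ (suc (suc m)) F₁ + detℕ (suc (suc m)) K₁         ≈⟨ +-cong detℕ-F₁ detℕ-K₁ ⟩
      x * (x * d) - q
        ≈⟨ +-cong (sym (*-assoc x x d)) (-‿cong (sym (trans (*-congʳ (sign-square (suc m))) (*-identityˡ q)))) ⟩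
      (x * x) * d - (s * s) * q
        ≈⟨ +-congˡ (-‿cong (solve 2 (λ s q → (s :* s) :* q := (:- (:- s)) :* (s :* q)) refl s q)) ⟩
      (x * x) * d - sign (suc (suc (suc m))) * (s * q)      ≈⟨ +-cong (*-congˡ (sym (f-A m x))) (-‿cong (*-congˡ (sym f-A-neg))) ⟩
      (x * x) * f m (A m) x - sign (suc (suc (suc m))) * f (suc m) (A (suc m)) (- x) ∎
      where
      d q s : Carrier
      d = detℕ m (xI-A m)
      q = detℕ (suc m) xI+A
      s = sign (suc m)

lemma4p3 : {c ℓ : Level} (R : CommutativeRing c ℓ) →
  let open CommutativeRing R
      open CharPoly R
  in
  -- (1a) n ≥ 1, written n = suc m
  ((m : ℕ) (x : Carrier) →
    f (suc m) (T (suc m)) (x + x) ≈ f (suc m) (T′ (suc m)) (x + x) - f m (T′ m) (x + x))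
  ×
  -- (1b) trigonometric form: s k = sin(kθ), co k = cos(kθ), x = cos θ;
  -- stated multiplied through by sin θ
  ((m : ℕ) (x : Carrier) (s co : ℕ → Carrier) →
    s 0 ≈ 0# → co 0 ≈ 1# →
    ((k : ℕ) → s (suc k) ≈ s k * co 1 + co k * s 1) →
    ((k : ℕ) → co (suc k) ≈ co k * co 1 - s k * s 1) →
    s 1 * s 1 + co 1 * co 1 ≈ 1# →
    co 1 ≈ x →
    s 1 * (f (suc m) (T′ (suc m)) (x + x) - f m (T′ m) (x + x)) ≈ s (suc (suc m)) - s (suc m))
  ×
  -- (2) n ≥ 2, written n = suc (suc m)
  ((m : ℕ) (x : Carrier) →
    f (suc (suc m)) (T (suc (suc m))) x ≈ x * f (suc m) (T (suc m)) x - f m (T m) x)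
  ×
  -- (3) n ≥ 2, written n = suc (suc m); (-1)^(n+1) = sign (n + 1)
  ((m : ℕ) (x : Carrier) →
    f (suc (suc m)) (A (suc (suc m))) x
      ≈ (x * x) * f m (A m) x - sign (suc (suc (suc m))) * f (suc m) (A (suc m)) (- x))
lemma4p3 R =
    (λ m x → f-T≈f-T′-f-T′ (x + x) m)
  , (λ m x s co _ _ s-suc co-suc pythagoras co₁≈x → SineMultiples.s₁*[f-T′-f-T′]≈s-s x s co s-suc co-suc pythagoras co₁≈x m)
  , (λ m x → f-T-recurrence x m)
  , (λ m x → AntiTriangular.f-A-recurrence m x)
  where
  open CommutativeRing R using (_+_)
  open CharacteristicMatrices R
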